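{- Let $a$ be a positive integer such that every natural number can be written as the sum of three terms of the sequence $\left( \left\lfloor\frac{n^2}{a}\right\rfloor \right)_{n\in \mathbb{N}}$. Then for every integer $k>0$, every natural number can be written as the sum of three terms of the sequence $\left( \left\lfloor\frac{n^2}{ak^2}\right\rfloor \right)_{n\in \mathbb{N}}$.
   Context: $\mathbb{N}$ denotes the set of non-negative integers and $\lfloor\cdot\rfloor$ the integer part function. "Sum of three terms" means $N=\left\lfloor \frac{A^2}{b}\right\rfloor+\left\lfloor \frac{B^2}{b}\right\rfloor+\left\lfloor \frac{C^2}{b}\right\rfloor$ for some $A,B,C\in\mathbb{N}$, where $b$ is the relevant denominator. -}

module Defs where

open import Data.Nat using (ℕ; _+_; _*_; NonZero)
open import Data.Nat.DivMod using (_/_)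
open import Data.Product using (∃-syntax)
open import Relation.Binary.PropositionalEquality using (_≡_)

SumOfThree : (b : ℕ) → .{{NonZero b}} → ℕ → Set
SumOfThree b N = ∃[ A ] ∃[ B ] ∃[ C ] (N ≡ (A * A) / b + (B * B) / b + (C * C) / b)

-- The common factor k² cancels in the floor quotient, ⌊(nk)² / (ak²)⌋ = ⌊n² / a⌋,
-- so multiplying the three witnesses by k turns a representation for a into one for ak².
module Submission where

open import Defs
open import Data.Nat using (ℕ; _*_; _+_; NonZero)
open import Data.Nat.Properties using (m*n≢0)
open import Data.Nat.DivMod using (_/_; m*n/o*n≡m/o)
open import Data.Product using (_,_)
open import Relation.Binary.PropositionalEquality using (_≡_; refl; cong; cong₂; trans; sym; module ≡-Reasoning)
open import Data.Nat.Solver using (module +-*-Solver)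
open +-*-Solver using (solve; _:*_; _:=_)

[m*k]*[m*k]≡[m*m]*[k*k] : ∀ m k → (m * k) * (m * k) ≡ (m * m) * (k * k)
[m*k]*[m*k]≡[m*m]*[k*k] = solve 2 (λ m k → (m :* k) :* (m :* k) := (m :* m) :* (k :* k)) refl

[m*k]²/[a*k²]≡m²/a : ∀ m a k .{{_ : NonZero a}} .{{_ : NonZero (a * (k * k))}} →
                     ((m * k) * (m * k)) / (a * (k * k)) ≡ (m * m) / a
[m*k]²/[a*k²]≡m²/a m a k = begin
  ((m * k) * (m * k)) / (a * (k * k))  ≡⟨ cong (_/ (a * (k * k))) ([m*k]*[m*k]≡[m*m]*[k*k] m k) ⟩
  ((m * m) * (k * k)) / (a * (k * k))  ≡⟨ m*n/o*n≡m/o (m * m) (k * k) a ⟩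
  (m * m) / a                          ∎
  where open ≡-Reasoning

SumOfThree-scale : ∀ a k .{{_ : NonZero a}} .{{_ : NonZero (a * (k * k))}} {N} →
                   SumOfThree a N → SumOfThree (a * (k * k)) N
SumOfThree-scale a k (A , B , C , N≡) =
  A * k , B * k , C * k ,
  trans N≡ (sym (cong₂ _+_ (cong₂ _+_ (term A) (term B)) (term C)))
  where
  term : ∀ m → ((m * k) * (m * k)) / (a * (k * k)) ≡ (m * m) / a
  term m = [m*k]²/[a*k²]≡m²/a m a k

mainTheorem3 : (a : ℕ) → .{{a≢0 : NonZero a}} →
    ((N : ℕ) → SumOfThree a N) →
    (k : ℕ) → .{{k≢0 : NonZero k}} →
    (N : ℕ) → SumOfThree (a * (k * k)) {{m*n≢0 a (k * k) {{a≢0}} {{m*n≢0 k k {{k≢0}} {{k≢0}}}}}} N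
mainTheorem3 a {{a≢0}} sumOfThree k {{k≢0}} N =
  SumOfThree-scale a k {{a≢0}} {{m*n≢0 a (k * k) {{a≢0}} {{m*n≢0 k k {{k≢0}} {{k≢0}}}}}} (sumOfThree N)
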